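{- Let $G$ be a connected graph with $n(G)$ vertices and $m(G)$ edges, and let $\widehat{S(G)}$ be the graph obtained from the subdivision graph $S(G)$ by adding an edge between every two distinct vertices of $V(S(G))\setminus V(G)$. Then $$\mathrm{sg}\big(\widehat{S(G)}\big) = n(G)\quad\text{and}\quad \mathrm{sgc}\big(\widehat{S(G)}\big) \ge \min\Big\{k:\ \sum_{i=1}^k (n(G)-i) \ge m(G)\Big\}.$$
   Context: Graphs are finite and simple; strong geodetic notions are considered for connected graphs. For a graph $G$ and $S\subseteq V(G)$, one fixes for each unordered pair $\{x,y\}$ of distinct vertices of $S$ a single shortest $x,y$-path $\widetilde g(x,y)$; $S$ is a strong geodetic set if for some such choice the union of the vertex sets of the chosen paths equals $V(G)$ (for a one-vertex graph, that vertex forms a strong geodetic set). $\mathrm{sg}(G)$ is the minimum size of a strong geodetic set; a minimum one is an sg-set. For a strong geodetic set $S$, a set $X\subseteq S$ is a strong geodetic core for $S$ if there exists a choice of fixed shortest paths $\widetilde g(x,y)$ for pairs of $S$ such that $\bigcup_{(u,v)\in X\times S} V(\widetilde g(u,v)) = V(G)$. $\mathrm{sgc}(S)$ is the minimum size of a strong geodetic core for $S$, and $\mathrm{sgc}(G)=\min\{\mathrm{sgc}(S): S \text{ an sg-set of } G\}$. The subdivision graph $S(G)$ is obtained from $G$ by subdividing each edge exactly once; $n(G)$ and $m(G)$ denote order and size. -}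

module Defs where

open import Data.Nat using (ℕ; zero; suc; _+_; _∸_; _≤_)
open import Data.Fin using (Fin; splitAt) renaming (_<_ to _<ᶠ_)
open import Data.Fin.Subset using (Subset; _∈_; _⊆_; ∣_∣; ⊤)
open import Data.List using (List; length; lookup; map; upTo)
open import Data.Nat.ListAction using (sum)
open import Data.List.Relation.Unary.All using (All)
open import Data.List.Relation.Unary.Unique.Propositional using (Unique)
import Data.List.Membership.Propositional as LM
open import Data.Product using (Σ; ∃; ∃-syntax; _×_; _,_; proj₁; proj₂)
open import Data.Sum using (_⊎_; inj₁; inj₂)
open import Data.Empty using (⊥)
open import Relation.Binary.PropositionalEquality using (_≡_; _≢_)

record Graph : Set₁ where
  field
    V   : ℕ
    Adj : Fin V → Fin V → Set
open Graph public

data Walk (G : Graph) : Fin (V G) → Fin (V G) → ℕ → Set where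
  here : ∀ x → Walk G x x 0
  step : ∀ {x y z k} → Adj G x y → Walk G y z k → Walk G x z (suc k)

data OnWalk {G : Graph} (w : Fin (V G)) : ∀ {x y k} → Walk G x y k → Set where
  on-here  : OnWalk w (here w)
  on-start : ∀ {y z k} (a : Adj G w y) (p : Walk G y z k) → OnWalk w (step a p)
  on-later : ∀ {x y z k} (a : Adj G x y) {p : Walk G y z k} → OnWalk w p → OnWalk w (step a p)

Connected : Graph → Set
Connected G = ∀ x y → ∃[ k ] Walk G x y k

record ShortestPath (G : Graph) (x y : Fin (V G)) : Set where
  field
    len     : ℕ
    path    : Walk G x y len
    minimal : ∀ k → Walk G x y k → len ≤ k
open ShortestPath public

-- A choice of a single fixed shortest path for each unordered pair {x,y}
-- of distinct vertices of S (indexed by the ordered representative x < y).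
PathChoice : (G : Graph) → Subset (V G) → Set
PathChoice G S = ∀ x y → x ∈ S → y ∈ S → x <ᶠ y → ShortestPath G x y

CoveredVia : (G : Graph) (S X : Subset (V G)) → PathChoice G S → Fin (V G) → Set
CoveredVia G S X g w =
  Σ (Fin (V G)) λ x → Σ (Fin (V G)) λ y →
  Σ (x ∈ S) λ xS → Σ (y ∈ S) λ yS → Σ (x <ᶠ y) λ x<y →
    (x ∈ X ⊎ y ∈ X) × OnWalk w (path (g x y xS yS x<y))

-- Strong geodetic set (with the convention for the one-vertex graph).
IsStrongGeodetic : (G : Graph) → Subset (V G) → Set
IsStrongGeodetic G S =
  (V G ≡ 1 × S ≡ ⊤) ⊎
  (Σ (PathChoice G S) λ g → ∀ w → CoveredVia G S S g w)

SgEq : Graph → ℕ → Set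
SgEq G k =
  (Σ (Subset (V G)) λ S → IsStrongGeodetic G S × ∣ S ∣ ≡ k) ×
  (∀ S → IsStrongGeodetic G S → k ≤ ∣ S ∣)

IsSgSet : (G : Graph) → Subset (V G) → Set
IsSgSet G S = IsStrongGeodetic G S × (∀ T → IsStrongGeodetic G T → ∣ S ∣ ≤ ∣ T ∣)

-- X ⊆ S is a strong geodetic core for S: for some choice of fixed shortest
-- paths, the union of V(g(u,v)) over (u,v) ∈ X × S is V(G).  For u = v the
-- shortest u,u-path is the trivial path {u}, so vertices of X are covered.
IsCore : (G : Graph) (S X : Subset (V G)) → Set
IsCore G S X =
  X ⊆ S ×
  (Σ (PathChoice G S) λ g → ∀ w → w ∈ X ⊎ CoveredVia G S X g w)

SgcGe : Graph → ℕ → Set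
SgcGe G k = ∀ S X → IsSgSet G S → IsCore G S X → k ≤ ∣ X ∣

-- Simple graphs given by an edge list (each edge {x,y} stored once as
-- (x , y) with x < y).

record SimpleGraph : Set where
  field
    n       : ℕ
    edges   : List (Fin n × Fin n)
    ordered : All (λ e → proj₁ e <ᶠ proj₂ e) edges
    unique  : Unique edges
open SimpleGraph public

m : SimpleGraph → ℕ
m G = length (edges G)

toGraph : SimpleGraph → Graph
toGraph G = record
  { V   = n G
  ; Adj = λ x y → (x , y) LM.∈ edges G ⊎ (y , x) LM.∈ edges G }

-- The graph Ŝ(G): vertices Fin (n + m), first n original vertices,
-- the remaining m the subdivision vertices (one per edge); each subdivision
-- vertex is adjacent to the two endpoints of its edge, and all subdivision
-- vertices are pairwise adjacent.
hatAdj' : (G : SimpleGraph) → Fin (n G) ⊎ Fin (m G) → Fin (n G) ⊎ Fin (m G) → Set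
hatAdj' G (inj₁ _) (inj₁ _) = ⊥
hatAdj' G (inj₁ v) (inj₂ e) = v ≡ proj₁ (lookup (edges G) e) ⊎ v ≡ proj₂ (lookup (edges G) e)
hatAdj' G (inj₂ e) (inj₁ v) = v ≡ proj₁ (lookup (edges G) e) ⊎ v ≡ proj₂ (lookup (edges G) e)
hatAdj' G (inj₂ e) (inj₂ f) = e ≢ f

hatS : SimpleGraph → Graph
hatS G = record
  { V   = n G + m G
  ; Adj = λ x y → hatAdj' G (splitAt (n G) x) (splitAt (n G) y) }

-- Σ_{i=1}^k (n - i)   (n ∸ i is never truncated where it matters).

sumTo : ℕ → ℕ → ℕ
sumTo nn k = sum (map (λ j → nn ∸ suc j) (upTo k))

IsLeast : (ℕ → Set) → ℕ → Set
IsLeast P k = P k × (∀ j → P j → k ≤ j)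

module Submission where

-- The neighbours of an original vertex are
-- subdivision vertices, which are pairwise adjacent, so an original vertex can be bypassed
-- and never lies strictly inside a shortest path; and two distinct originals are joined by a
-- shortest path a – e₁ – e₂ – b of length 3, or a – e – b of length 2 when ab is an edge
-- (a "route").  Hence every strong geodetic set contains the n originals, and the originals
-- themselves form one (the edge pq is covered by the path between p and q): sg = n.
-- For the core bound, an sg-set consists exactly of the originals.  Given a core X, each edge
-- e is charged to a pair a < b of originals with a or b in X: to its own ends if it meets X,
-- and otherwise to a chosen path through its subdivision vertex.  Routes show that this
-- charging is injective, and there are Σ_{i=1}^{|X|} (n - i) such pairs.

open import Defs
open import Data.Bool using (true; false)
open import Data.Empty using (⊥-elim)
open import Data.Fin using (Fin; zero; suc; _↑ˡ_; _↑ʳ_; splitAt; join)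
  renaming (_<_ to _<ᶠ_)
import Data.Fin.Properties as FinP
open import Data.Fin.Subset using (Subset; _∈_; _∉_; _⊆_; ∣_∣; ⊤) renaming (⊥ to ∅)
open import Data.Fin.Subset.Properties
  using (∈⊤; ∉⊥; ∣⊥∣≡0; ∣p∣≤n; drop-there; p⊆q⇒∣p∣≤∣q∣; p⊂q⇒∣p∣<∣q∣; _∈?_)
open import Data.List as List using (List; length)
open import Data.List.Properties using (map-applyUpTo)
open import Data.List.Membership.Propositional.Properties using (∈-lookup)
open import Data.List.Relation.Unary.All as All using (All)
import Data.List.Relation.Unary.Any as Any
open import Data.List.Relation.Unary.Any.Properties using (lookup-index)
open import Data.List.Relation.Unary.AllPairs.Core using (AllPairs)
open import Data.List.Relation.Unary.Unique.Propositional using (Unique)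
open import Data.Nat using (ℕ; zero; suc; _+_; _≤_; _<_; z≤n; s≤s; _≟_)
open import Data.Nat.ListAction using (sum)
open import Data.Nat.Properties
  using (≤-trans; ≤-reflexive; <-≤-trans; ≤⇒≯; n<1+n; m<n⇒m<1+n; n≤1+n; n≮n; +-commutativeSemigroup)
open import Algebra.Properties.CommutativeSemigroup +-commutativeSemigroup using (x∙yz≈y∙xz)
open import Data.Product as Product using (Σ; _×_; _,_; proj₁; proj₂)
open import Data.Sum as Sum using (_⊎_; inj₁; inj₂)
open import Data.Vec using ([]; _∷_; here; there; _++_; take)
open import Data.Vec.Properties.WithK using ([]=-irrelevant)
open import Function using (_∘_)
open import Relation.Binary.Definitions using (tri<; tri≈; tri>)
open import Relation.Binary.PropositionalEquality
open import Relation.Nullary using (¬_; Dec; yes; no)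
open import Relation.Nullary.Decidable using (_⊎-dec_; _×-dec_; ¬?)

-- Finite subsets of a sum N + M.

leftPart : ∀ N M → Subset (N + M)
leftPart N M = ⊤ {n = N} ++ ∅ {n = M}

∣leftPart∣ : ∀ N M → ∣ leftPart N M ∣ ≡ N
∣leftPart∣ zero    M = ∣⊥∣≡0 M
∣leftPart∣ (suc N) M = cong suc (∣leftPart∣ N M)

↑ˡ∈leftPart : ∀ {N M} (i : Fin N) → (i ↑ˡ M) ∈ leftPart N M
↑ˡ∈leftPart zero    = here
↑ˡ∈leftPart (suc i) = there (↑ˡ∈leftPart i)

↑ʳ∉leftPart : ∀ N {M} (j : Fin M) → (N ↑ʳ j) ∉ leftPart N M
↑ʳ∉leftPart zero    j j∈∅         = ∉⊥ j∈∅
↑ʳ∉leftPart (suc N) j (there j∈L) = ↑ʳ∉leftPart N j j∈L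

leftPart-⊤ : ∀ {N M} → N ≡ 1 → M ≡ 0 → leftPart N M ≡ ⊤
leftPart-⊤ refl refl = refl

↑ˡ≢↑ʳ : ∀ {N M} (i : Fin N) (j : Fin M) → i ↑ˡ M ≢ N ↑ʳ j
↑ˡ≢↑ʳ {N} {M} i j eq
  with trans (sym (FinP.splitAt-↑ˡ N i M)) (trans (cong (splitAt N) eq) (FinP.splitAt-↑ʳ N M j))
... | ()

∈-take : ∀ N {M} (X : Subset (N + M)) {i} → (i ↑ˡ M) ∈ X → i ∈ take N X
∈-take (suc N) (_ ∷ X) {zero}  here         = here
∈-take (suc N) (_ ∷ X) {suc i} (there i∈X) = there (∈-take N X i∈X)

∣take∣≤ : ∀ N {M} (X : Subset (N + M)) → ∣ take N X ∣ ≤ ∣ X ∣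
∣take∣≤ zero    X           = z≤n
∣take∣≤ (suc N) (true ∷ X)  = s≤s (∣take∣≤ N X)
∣take∣≤ (suc N) (false ∷ X) = ∣take∣≤ N X

another : ∀ {N} → N ≢ 1 → (a : Fin N) → Σ (Fin N) λ u → u ≢ a
another {suc zero}    N≢1 _       = ⊥-elim (N≢1 refl)
another {suc (suc N)} _   zero    = suc zero , λ ()
another {suc (suc N)} _   (suc a) = zero , λ ()

no-edges : ∀ {K} → K ≡ 1 → (es : List (Fin K × Fin K)) → All (λ e → proj₁ e <ᶠ proj₂ e) es →
           length es ≡ 0
no-edges refl List.[]                   _              = refl
no-edges refl ((zero , zero) List.∷ _) (() All.∷ _)

lookup-injective : ∀ {A : Set} {xs : List A} → Unique xs →
                   ∀ i j → List.lookup xs i ≡ List.lookup xs j → i ≡ j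
lookup-injective (_ AllPairs.∷ _)  zero    zero    _  = refl
lookup-injective (x≢ AllPairs.∷ _) zero    (suc j) eq = ⊥-elim (All.lookup x≢ (∈-lookup j) eq)
lookup-injective (x≢ AllPairs.∷ _) (suc i) zero    eq = ⊥-elim (All.lookup x≢ (∈-lookup i) (sym eq))
lookup-injective (_ AllPairs.∷ u)  (suc i) (suc j) eq = cong suc (lookup-injective u i j eq)

-- Counting the pairs meeting a subset.

sumTo-suc : ∀ N k → sumTo (suc N) (suc k) ≡ N + sumTo N k
sumTo-suc N k =
  cong (λ xs → N + sum xs) (trans (map-applyUpTo suc _ k) (sym (map-applyUpTo (λ j → j) _ k)))

sumTo-shift : ∀ N k → k ≤ N → sumTo (suc N) k ≡ k + sumTo N k
sumTo-shift N       zero    _         = refl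
sumTo-shift (suc N) (suc k) (s≤s k≤N) = begin
  sumTo (suc (suc N)) (suc k)  ≡⟨ sumTo-suc (suc N) k ⟩
  suc N + sumTo (suc N) k      ≡⟨ cong (suc N +_) (sumTo-shift N k k≤N) ⟩
  suc (N + (k + sumTo N k))    ≡⟨ cong suc (x∙yz≈y∙xz N k (sumTo N k)) ⟩
  suc k + (N + sumTo N k)      ≡⟨ cong (suc k +_) (sym (sumTo-suc N k)) ⟩
  suc k + sumTo (suc N) (suc k) ∎
  where open ≡-Reasoning

record HitPair {N} (X : Subset N) : Set where
  constructor hitPair
  field
    lo hi : Fin N
    lo<hi : lo <ᶠ hi
    hits  : lo ∈ X ⊎ hi ∈ X
open HitPair

-- The number of such pairs, by recursion on X: with X = β ∷ X′, the pairs with lo = 0 number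
-- N if 0 ∈ X and |X′| otherwise; the remaining pairs are those meeting X′.
hitCount : ∀ {N} → Subset N → ℕ
hitCount []                = 0
hitCount {suc N} (true ∷ X) = N + hitCount X
hitCount (false ∷ X)        = ∣ X ∣ + hitCount X

hitCount-sumTo : ∀ {N} (X : Subset N) → hitCount X ≡ sumTo N ∣ X ∣
hitCount-sumTo []                = refl
hitCount-sumTo {suc N} (true ∷ X) =
  trans (cong (N +_) (hitCount-sumTo X)) (sym (sumTo-suc N ∣ X ∣))
hitCount-sumTo {suc N} (false ∷ X) =
  trans (cong (∣ X ∣ +_) (hitCount-sumTo X)) (sym (sumTo-shift N ∣ X ∣ (∣p∣≤n X)))

rank : ∀ {N} (X : Subset N) {i} → i ∈ X → Fin ∣ X ∣
rank (true ∷ X)  here        = zero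
rank (true ∷ X)  (there i∈X) = suc (rank X i∈X)
rank (false ∷ X) (there i∈X) = rank X i∈X

rank-injective : ∀ {N} (X : Subset N) {i j} (i∈X : i ∈ X) (j∈X : j ∈ X) →
                 rank X i∈X ≡ rank X j∈X → i ≡ j
rank-injective (true ∷ X)  here        here        _  = refl
rank-injective (true ∷ X)  (there i∈X) (there j∈X) eq =
  cong suc (rank-injective X i∈X j∈X (FinP.suc-injective eq))
rank-injective (false ∷ X) (there i∈X) (there j∈X) eq = cong suc (rank-injective X i∈X j∈X eq)

tail-hits : ∀ {N β} {X : Subset N} {a b} → suc a ∈ (β ∷ X) ⊎ suc b ∈ (β ∷ X) → a ∈ X ⊎ b ∈ X
tail-hits = Sum.map drop-there drop-there

-- An explicit numbering of the pairs meeting X following hitCount: a pair (0, b+1) gets the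
-- number b if 0 ∈ X and the rank of b in X otherwise; the other pairs come after.
encode : ∀ {N} (X : Subset N) a b → a <ᶠ b → a ∈ X ⊎ b ∈ X → Fin (hitCount X)
encode {suc N} (true ∷ X) zero    (suc b) _         _   = b ↑ˡ hitCount X
encode (false ∷ X)        zero    (suc b) _         (inj₂ b∈X) = rank X (drop-there b∈X) ↑ˡ hitCount X
encode {suc N} (true ∷ X) (suc a) (suc b) (s≤s a<b) hit = N ↑ʳ encode X a b a<b (tail-hits hit)
encode (false ∷ X)        (suc a) (suc b) (s≤s a<b) hit = ∣ X ∣ ↑ʳ encode X a b a<b (tail-hits hit)

-- The numbering is injective (pairs starting at 0 and the others land in disjoint blocks).
encode-injective : ∀ {N} (X : Subset N) a b lt hit a′ b′ lt′ hit′ →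
                   encode X a b lt hit ≡ encode X a′ b′ lt′ hit′ → a ≡ a′ × b ≡ b′
encode-injective (true ∷ X) zero (suc b) _ _ zero (suc b′) _ _ eq =
  refl , cong suc (FinP.↑ˡ-injective _ b b′ eq)
encode-injective (false ∷ X) zero (suc b) _ (inj₂ b∈X) zero (suc b′) _ (inj₂ b′∈X) eq =
  refl , cong suc (rank-injective X (drop-there b∈X) (drop-there b′∈X) (FinP.↑ˡ-injective _ _ _ eq))
encode-injective (true ∷ X) zero (suc _) _ _ (suc _) (suc _) (s≤s _) _ eq = ⊥-elim (↑ˡ≢↑ʳ _ _ eq)
encode-injective (false ∷ X) zero (suc _) _ (inj₂ _) (suc _) (suc _) (s≤s _) _ eq = ⊥-elim (↑ˡ≢↑ʳ _ _ eq)
encode-injective (true ∷ X) (suc _) (suc _) (s≤s _) _ zero (suc _) _ _ eq = ⊥-elim (↑ˡ≢↑ʳ _ _ (sym eq))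
encode-injective (false ∷ X) (suc _) (suc _) (s≤s _) _ zero (suc _) _ (inj₂ _) eq =
  ⊥-elim (↑ˡ≢↑ʳ _ _ (sym eq))
encode-injective {suc N} (true ∷ X) (suc a) (suc b) (s≤s lt) hit (suc a′) (suc b′) (s≤s lt′) hit′ eq =
  Product.map (cong suc) (cong suc)
    (encode-injective X a b lt (tail-hits hit) a′ b′ lt′ (tail-hits hit′) (FinP.↑ʳ-injective N _ _ eq))
encode-injective (false ∷ X) (suc a) (suc b) (s≤s lt) hit (suc a′) (suc b′) (s≤s lt′) hit′ eq =
  Product.map (cong suc) (cong suc)
    (encode-injective X a b lt (tail-hits hit) a′ b′ lt′ (tail-hits hit′) (FinP.↑ʳ-injective ∣ X ∣ _ _ eq))

hitPairs-bound : ∀ {N K} (X : Subset N) (pair : Fin K → HitPair X) →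
                 (∀ i j → lo (pair i) ≡ lo (pair j) → hi (pair i) ≡ hi (pair j) → i ≡ j) →
                 K ≤ sumTo N ∣ X ∣
hitPairs-bound {K = K} X pair pair-injective =
  subst (K ≤_) (hitCount-sumTo X) (FinP.injective⇒≤ code-injective)
  where
  code : Fin K → Fin (hitCount X)
  code i = encode X (lo (pair i)) (hi (pair i)) (lo<hi (pair i)) (hits (pair i))

  code-injective : ∀ {i j} → code i ≡ code j → i ≡ j
  code-injective {i} {j} eq with encode-injective X _ _ _ _ _ _ _ _ eq
  ... | lo≡ , hi≡ = pair-injective i j lo≡ hi≡

-- Walks and shortest paths in an arbitrary graph.

onStart : ∀ {G x y k} (p : Walk G x y k) → OnWalk x p
onStart (here _)   = on-here
onStart (step a p) = on-start a p

onEnd : ∀ {G x y k} (p : Walk G x y k) → OnWalk y p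
onEnd (here _)   = on-here
onEnd (step a p) = on-later a (onEnd p)

least : ∀ {Q : ℕ → Set} → (∀ k → Dec (Q k)) → ∀ {B} → Q B → Σ ℕ (IsLeast Q)
least Q? {B} qB with Q? 0
... | yes q0 = 0 , q0 , λ _ _ → z≤n
least Q? {zero}  qB | no ¬q0 = ⊥-elim (¬q0 qB)
least Q? {suc B} qB | no ¬q0 with least (Q? ∘ suc) {B} qB
... | k , qk , k-least = suc k , qk , λ { zero q0 → ⊥-elim (¬q0 q0) ; (suc j) qj → s≤s (k-least j qj) }

-- With decidable adjacency, the existence of a walk of given length is decidable, so any
-- walk yields a shortest path between its ends.
module _ (G : Graph) (adj? : ∀ x y → Dec (Adj G x y)) where

  walk? : ∀ k x y → Dec (Walk G x y k)
  walk? zero x y with x FinP.≟ y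
  ... | yes refl = yes (here x)
  ... | no x≢y   = no λ { (here _) → x≢y refl }
  walk? (suc k) x y with FinP.any? (λ z → adj? x z ×-dec walk? k z y)
  ... | yes (z , xz , zy) = yes (step xz zy)
  ... | no ∄z             = no λ { (step {y = z} xz zy) → ∄z (z , xz , zy) }

  shortestPath : ∀ {x y k} → Walk G x y k → ShortestPath G x y
  shortestPath {x} {y} w with least (λ j → walk? j x y) w
  ... | j , wj , j-least = record { len = j ; path = wj ; minimal = j-least }

end-covered : ∀ {G S} (g : PathChoice G S) {x y} → x ∈ S → y ∈ S → x ≢ y → CoveredVia G S S g x
end-covered g {x} {y} x∈S y∈S x≢y with FinP.<-cmp x y
... | tri< x<y _ _ = x , y , x∈S , y∈S , x<y , inj₁ x∈S , onStart (path (g x y x∈S y∈S x<y))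
... | tri≈ _ x≡y _ = ⊥-elim (x≢y x≡y)
... | tri> _ _ y<x = y , x , y∈S , x∈S , y<x , inj₂ x∈S , onEnd (path (g y x y∈S x∈S y<x))

choice-irrelevant : ∀ {G S} (g : PathChoice G S) {x y} (x∈S x∈S′ : x ∈ S) (y∈S y∈S′ : y ∈ S)
                    (x<y x<y′ : x <ᶠ y) → g x y x∈S y∈S x<y ≡ g x y x∈S′ y∈S′ x<y′
choice-irrelevant g x∈S x∈S′ y∈S y∈S′ x<y x<y′
  rewrite []=-irrelevant x∈S x∈S′ | []=-irrelevant y∈S y∈S′ | FinP.<-irrelevant x<y x<y′ = refl

-- The structure of Ŝ(G).

module Subdivided (G : SimpleGraph) where

  N : ℕ
  N = n G

  M : ℕ
  M = m G

  H : Graph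
  H = hatS G

  endpoints : Fin M → Fin N × Fin N
  endpoints = List.lookup (edges G)

  Incident : Fin N → Fin M → Set
  Incident a e = a ≡ proj₁ (endpoints e) ⊎ a ≡ proj₂ (endpoints e)

  endpoints-ordered : ∀ e → proj₁ (endpoints e) <ᶠ proj₂ (endpoints e)
  endpoints-ordered e = All.lookup (ordered G) (∈-lookup e)

  endpoints-injective : ∀ {e f} → endpoints e ≡ endpoints f → e ≡ f
  endpoints-injective = lookup-injective (unique G) _ _

  endpoints-from-incidence : ∀ {p q e} → p <ᶠ q → Incident p e → Incident q e →
                             endpoints e ≡ (p , q)
  endpoints-from-incidence p<q (inj₁ refl) (inj₁ refl) = ⊥-elim (FinP.<-irrefl refl p<q)
  endpoints-from-incidence p<q (inj₁ refl) (inj₂ refl) = refl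
  endpoints-from-incidence {e = e} p<q (inj₂ refl) (inj₁ refl) =
    ⊥-elim (FinP.<-asym p<q (endpoints-ordered e))
  endpoints-from-incidence p<q (inj₂ refl) (inj₂ refl) = ⊥-elim (FinP.<-irrefl refl p<q)

  orig : Fin N → Fin (N + M)
  orig a = a ↑ˡ M

  sub : Fin M → Fin (N + M)
  sub e = N ↑ʳ e

  orig-injective : ∀ {a b} → orig a ≡ orig b → a ≡ b
  orig-injective = FinP.↑ˡ-injective M _ _

  sub-injective : ∀ {e f} → sub e ≡ sub f → e ≡ f
  sub-injective = FinP.↑ʳ-injective N _ _

  orig-< : ∀ {a b} → a <ᶠ b → orig a <ᶠ orig b
  orig-< {a} {b} = subst₂ _<_ (sym (FinP.toℕ-↑ˡ a M)) (sym (FinP.toℕ-↑ˡ b M))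

  orig-<⁻ : ∀ {a b} → orig a <ᶠ orig b → a <ᶠ b
  orig-<⁻ {a} {b} = subst₂ _<_ (FinP.toℕ-↑ˡ a M) (FinP.toℕ-↑ˡ b M)

  data Kind : Fin (N + M) → Set where
    original    : ∀ a → Kind (orig a)
    subdivision : ∀ e → Kind (sub e)

  kind : ∀ x → Kind x
  kind x = subst Kind (FinP.join-splitAt N M x) (kindOf (splitAt N x))
    where
    kindOf : ∀ s → Kind (join N M s)
    kindOf (inj₁ a) = original a
    kindOf (inj₂ e) = subdivision e

  toKinds : ∀ {x y p q} → splitAt N x ≡ p → splitAt N y ≡ q → Adj H x y → hatAdj' G p q
  toKinds refl refl xy = xy

  fromKinds : ∀ {x y p q} → splitAt N x ≡ p → splitAt N y ≡ q → hatAdj' G p q → Adj H x y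
  fromKinds refl refl xy = xy

  private
    kind-orig : ∀ a → splitAt N (orig a) ≡ inj₁ a
    kind-orig a = FinP.splitAt-↑ˡ N a M

    kind-sub : ∀ e → splitAt N (sub e) ≡ inj₂ e
    kind-sub e = FinP.splitAt-↑ʳ N M e

  ¬orig-orig : ∀ {a b} → ¬ Adj H (orig a) (orig b)
  ¬orig-orig {a} {b} = toKinds (kind-orig a) (kind-orig b)

  orig-sub : ∀ {a e} → Adj H (orig a) (sub e) → Incident a e
  orig-sub {a} {e} = toKinds (kind-orig a) (kind-sub e)

  sub-orig : ∀ {a e} → Adj H (sub e) (orig a) → Incident a e
  sub-orig {a} {e} = toKinds (kind-sub e) (kind-orig a)

  incident-orig-sub : ∀ {a e} → Incident a e → Adj H (orig a) (sub e)
  incident-orig-sub {a} {e} = fromKinds (kind-orig a) (kind-sub e)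

  incident-sub-orig : ∀ {a e} → Incident a e → Adj H (sub e) (orig a)
  incident-sub-orig {a} {e} = fromKinds (kind-sub e) (kind-orig a)

  sub-sub : ∀ {e f} → e ≢ f → Adj H (sub e) (sub f)
  sub-sub {e} {f} = fromKinds (kind-sub e) (kind-sub f)

  adj? : ∀ x y → Dec (Adj H x y)
  adj? x y = hatAdj? (splitAt N x) (splitAt N y)
    where
    hatAdj? : ∀ p q → Dec (hatAdj' G p q)
    hatAdj? (inj₁ _) (inj₁ _) = no λ ()
    hatAdj? (inj₁ a) (inj₂ e) = (a FinP.≟ proj₁ (endpoints e)) ⊎-dec (a FinP.≟ proj₂ (endpoints e))
    hatAdj? (inj₂ e) (inj₁ a) = (a FinP.≟ proj₁ (endpoints e)) ⊎-dec (a FinP.≟ proj₂ (endpoints e))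
    hatAdj? (inj₂ e) (inj₂ f) = ¬? (e FinP.≟ f)

  out-neighbour : ∀ {a v} → Adj H (orig a) v → Σ (Fin M) λ e → v ≡ sub e × Incident a e
  out-neighbour {v = v} av with kind v
  ... | original _    = ⊥-elim (¬orig-orig av)
  ... | subdivision e = e , refl , orig-sub av

  in-neighbour : ∀ {a u} → Adj H u (orig a) → Σ (Fin M) λ e → u ≡ sub e × Incident a e
  in-neighbour {u = u} ua with kind u
  ... | original _    = ⊥-elim (¬orig-orig ua)
  ... | subdivision e = e , refl , sub-orig ua

  -- Two neighbours of an original vertex are equal or adjacent (subdivision vertices form a clique).
  neighbours-linked : ∀ {u a v} → Adj H u (orig a) → Adj H (orig a) v → u ≡ v ⊎ Adj H u v
  neighbours-linked ua av with in-neighbour ua | out-neighbour av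
  ... | e , refl , _ | f , refl , _ with e FinP.≟ f
  ... | yes refl = inj₁ refl
  ... | no e≢f   = inj₂ (sub-sub e≢f)

  bypass : ∀ {x y k a} (p : Walk H x y k) → OnWalk (orig a) p → orig a ≢ x → orig a ≢ y →
           Σ ℕ λ k′ → k′ < k × Walk H x y k′
  bypass (here _)   on-here        a≢x _ = ⊥-elim (a≢x refl)
  bypass (step _ _) (on-start _ _) a≢x _ = ⊥-elim (a≢x refl)
  bypass {a = a} (step {y = s} xs q) (on-later _ on) _ a≢y with orig a FinP.≟ s
  ... | no a≢s with bypass q on a≢s a≢y
  ...   | k′ , k′<k , q′ = suc k′ , s≤s k′<k , step xs q′
  bypass (step _ (here _))        (on-later _ _) _ a≢y | yes refl = ⊥-elim (a≢y refl)
  bypass (step xa (step at rest)) (on-later _ _) _ _   | yes refl with neighbours-linked xa at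
  ... | inj₁ refl = _ , m<n⇒m<1+n (n<1+n _) , rest
  ... | inj₂ xt   = _ , n<1+n _ , step xt rest

  original-on-shortest : ∀ {x y a} (sp : ShortestPath H x y) → OnWalk (orig a) (path sp) →
                         orig a ≡ x ⊎ orig a ≡ y
  original-on-shortest {x} {y} {a} sp on with orig a FinP.≟ x | orig a FinP.≟ y
  ... | yes a≡x | _       = inj₁ a≡x
  ... | no _    | yes a≡y = inj₂ a≡y
  ... | no a≢x  | no a≢y with bypass (path sp) on a≢x a≢y
  ...   | k′ , k′<len , w = ⊥-elim (n≮n k′ (<-≤-trans k′<len (minimal sp k′ w)))

  two-step : ∀ {a b e} → Incident a e → Incident b e → Walk H (orig a) (orig b) 2
  two-step a∈e b∈e = step (incident-orig-sub a∈e) (step (incident-sub-orig b∈e) (here _))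

  edge-at : ∀ {a b k} → Walk (toGraph G) a b k → a ≢ b → Σ (Fin M) (Incident a)
  edge-at (here _)           a≢b = ⊥-elim (a≢b refl)
  edge-at (step (inj₁ ab) _) _   = Any.index ab , inj₁ (cong proj₁ (lookup-index ab))
  edge-at (step (inj₂ ba) _) _   = Any.index ba , inj₂ (cong proj₂ (lookup-index ba))

  walk≤3 : Connected (toGraph G) → ∀ {a b} → a ≢ b → Σ ℕ λ k → k ≤ 3 × Walk H (orig a) (orig b) k
  walk≤3 conn {a} {b} a≢b with edge-at (proj₂ (conn a b)) a≢b | edge-at (proj₂ (conn b a)) (a≢b ∘ sym)
  ... | e , a∈e | f , b∈f with e FinP.≟ f
  ... | yes refl = 2 , n≤1+n 2 , two-step a∈e b∈f
  ... | no e≢f   =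
    3 , ≤-reflexive refl ,
    step (incident-orig-sub a∈e) (step (sub-sub e≢f) (step (incident-sub-orig b∈f) (here _)))

  record Route {x y k} (p : Walk H x y k) (a b : Fin N) : Set where
    field
      first last : Fin M
      first-at   : Incident a first
      last-at    : Incident b last
      first-on   : OnWalk (sub first) p
      subs-on    : ∀ e → OnWalk (sub e) p → e ≡ first ⊎ e ≡ last
      short      : k ≤ 2 → first ≡ last

  -- By cases on the walk: lengths 0 and 1 are impossible between distinct originals, and
  -- the inner vertices of a walk of length 2 or 3 are neighbours of its ends.
  route : ∀ {x y k a b} (p : Walk H x y k) → x ≡ orig a → y ≡ orig b → a ≢ b → k ≤ 3 → Route p a b
  route (here _) refl x≡b a≢b _ = ⊥-elim (a≢b (orig-injective x≡b))
  route (step xy (here _)) refl refl _ _ = ⊥-elim (¬orig-orig xy)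
  route (step xs (step sy (here _))) refl refl _ _ with out-neighbour xs
  ... | e , refl , a∈e = record
    { first = e ; last = e ; first-at = a∈e ; last-at = sub-orig sy
    ; first-on = on-later xs (on-start sy _) ; subs-on = λ f on → subs on refl ; short = λ _ → refl }
    where
    subs : ∀ {w f} → OnWalk w (step xs (step sy (here _))) → w ≡ sub f → f ≡ e ⊎ f ≡ e
    subs (on-start _ _)                       eq = ⊥-elim (↑ˡ≢↑ʳ _ _ eq)
    subs (on-later _ (on-start _ _))          eq = inj₁ (sub-injective (sym eq))
    subs (on-later _ (on-later _ on-here))    eq = ⊥-elim (↑ˡ≢↑ʳ _ _ eq)
  route (step xs (step st (step ty (here _)))) refl refl _ _ with out-neighbour xs | in-neighbour ty
  ... | e , refl , a∈e | f , refl , b∈f = record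
    { first = e ; last = f ; first-at = a∈e ; last-at = b∈f
    ; first-on = on-later xs (on-start st _) ; subs-on = λ g on → subs on refl
    ; short = λ { (s≤s (s≤s ())) } }
    where
    subs : ∀ {w g} → OnWalk w (step xs (step st (step ty (here _)))) → w ≡ sub g → g ≡ e ⊎ g ≡ f
    subs (on-start _ _)                                 eq = ⊥-elim (↑ˡ≢↑ʳ _ _ eq)
    subs (on-later _ (on-start _ _))                    eq = inj₁ (sub-injective (sym eq))
    subs (on-later _ (on-later _ (on-start _ _)))       eq = inj₂ (sub-injective (sym eq))
    subs (on-later _ (on-later _ (on-later _ on-here))) eq = ⊥-elim (↑ˡ≢↑ʳ _ _ eq)
  route (step _ (step _ (step _ (step _ _)))) _ _ _ (s≤s (s≤s (s≤s ())))

  shortest-route : Connected (toGraph G) → ∀ {a b} (sp : ShortestPath H (orig a) (orig b)) → a ≢ b →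
                   Route (path sp) a b
  shortest-route conn sp a≢b with walk≤3 conn a≢b
  ... | k , k≤3 , w = route (path sp) refl refl a≢b (≤-trans (minimal sp k w) k≤3)

  edge-on-shortest : Connected (toGraph G) → ∀ ε →
                     (sp : ShortestPath H (orig (proj₁ (endpoints ε))) (orig (proj₂ (endpoints ε)))) →
                     OnWalk (sub ε) (path sp)
  edge-on-shortest conn ε sp = subst (λ e → OnWalk (sub e) (path sp)) first≡ε first-on
    where
    p<q : proj₁ (endpoints ε) <ᶠ proj₂ (endpoints ε)
    p<q = endpoints-ordered ε
    open Route (shortest-route conn sp (FinP.<⇒≢ p<q))
    first≡ε : first ≡ ε
    first≡ε = endpoints-injective (endpoints-from-incidence p<q first-at
      (subst (Incident _) (sym (short (minimal sp 2 (two-step (inj₁ refl) (inj₂ refl))))) last-at))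

-- sg(Ŝ(G)) = n(G).

module StrongGeodetic (G : SimpleGraph) where
  open Subdivided G

  originals : Subset (N + M)
  originals = leftPart N M

  original-of : ∀ {x} → x ∈ originals → Σ (Fin N) λ a → x ≡ orig a
  original-of {x} x∈O with kind x
  ... | original a    = a , refl
  ... | subdivision e = ⊥-elim (↑ʳ∉leftPart N e x∈O)

  -- Every strong geodetic set contains all originals: an original vertex can only be covered
  -- as an end of a chosen shortest path.
  orig∈sg : ∀ {S} → IsStrongGeodetic H S → ∀ a → orig a ∈ S
  orig∈sg (inj₁ (_ , refl)) a = ∈⊤
  orig∈sg (inj₂ (g , covered)) a with covered (orig a)
  ... | x , y , x∈S , y∈S , x<y , _ , on with original-on-shortest (g x y x∈S y∈S x<y) on
  ...   | inj₁ refl = x∈S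
  ...   | inj₂ refl = y∈S

  originals⊆sg : ∀ {S} → IsStrongGeodetic H S → originals ⊆ S
  originals⊆sg sg x∈O with original-of x∈O
  ... | a , refl = orig∈sg sg a

  sg-lower-bound : ∀ S → IsStrongGeodetic H S → N ≤ ∣ S ∣
  sg-lower-bound S sg = subst (_≤ ∣ S ∣) (∣leftPart∣ N M) (p⊆q⇒∣p∣≤∣q∣ (originals⊆sg sg))

  -- A strong geodetic set with at most N elements consists of originals only, since a
  -- subdivision vertex in it would make it strictly larger than `originals`.
  small-sg-original : ∀ {S} → IsStrongGeodetic H S → ∣ S ∣ ≤ N → ∀ {x} → x ∈ S →
                      Σ (Fin N) λ a → x ≡ orig a
  small-sg-original {S} sg ∣S∣≤N {x} x∈S with kind x
  ... | original a    = a , refl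
  ... | subdivision e = ⊥-elim (≤⇒≯ ∣S∣≤N (subst (_< ∣ S ∣) (∣leftPart∣ N M) ∣O∣<∣S∣))
    where
    ∣O∣<∣S∣ : ∣ originals ∣ < ∣ S ∣
    ∣O∣<∣S∣ = p⊂q⇒∣p∣<∣q∣ (originals⊆sg sg , sub e , x∈S , ↑ʳ∉leftPart N e)

  module _ (conn : Connected (toGraph G)) where

    chosen : PathChoice H originals
    chosen x y x∈O y∈O x<y with original-of x∈O | original-of y∈O
    ... | a , refl | b , refl =
      shortestPath H adj? (proj₂ (proj₂ (walk≤3 conn (FinP.<⇒≢ (orig-<⁻ x<y)))))

    -- Original vertices are covered as ends (using a second vertex), subdivision vertices by
    -- the path between the ends of their edge.
    originals-cover : N ≢ 1 → ∀ w → CoveredVia H originals originals chosen w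
    originals-cover N≢1 w with kind w
    ... | original a with another N≢1 a
    ...   | u , u≢a = end-covered chosen (↑ˡ∈leftPart a) (↑ˡ∈leftPart u) (u≢a ∘ sym ∘ orig-injective)
    originals-cover N≢1 w | subdivision ε =
      orig p , orig q , p∈O , q∈O , p<q , inj₁ p∈O , edge-on-shortest conn ε (chosen _ _ p∈O q∈O p<q)
      where
      p q : Fin N
      p = proj₁ (endpoints ε)
      q = proj₂ (endpoints ε)
      p∈O : orig p ∈ originals
      p∈O = ↑ˡ∈leftPart p
      q∈O : orig q ∈ originals
      q∈O = ↑ˡ∈leftPart q
      p<q : orig p <ᶠ orig q
      p<q = orig-< (endpoints-ordered ε)

    -- The originals form a strong geodetic set; for N = 1 (no edges) by the one-vertex convention.
    originals-sg : IsStrongGeodetic H originals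
    originals-sg with N ≟ 1
    ... | no N≢1  = inj₂ (chosen , originals-cover N≢1)
    ... | yes N≡1 = inj₁ (cong₂ _+_ N≡1 M≡0 , leftPart-⊤ N≡1 M≡0)
      where
      M≡0 : M ≡ 0
      M≡0 = no-edges N≡1 (edges G) (ordered G)

    sg-value : SgEq H N
    sg-value = (originals , originals-sg , ∣leftPart∣ N M) , sg-lower-bound

module CoreBound (G : SimpleGraph) (conn : Connected (toGraph G)) (S X : Subset (n G + m G))
                 (S-sg-set : IsSgSet (hatS G) S) (X-core : IsCore (hatS G) S X) where
  open Subdivided G
  open StrongGeodetic G

  X⊆S : X ⊆ S
  X⊆S = proj₁ X-core

  g : PathChoice H S
  g = proj₁ (proj₂ X-core)

  covered : ∀ w → w ∈ X ⊎ CoveredVia H S X g w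
  covered = proj₂ (proj₂ X-core)

  -- S is no larger than `originals`, hence consists of original vertices only.
  S-original : ∀ {x} → x ∈ S → Σ (Fin N) λ a → x ≡ orig a
  S-original = small-sg-original (proj₁ S-sg-set)
    (≤-trans (proj₂ S-sg-set originals (originals-sg conn)) (≤-reflexive (∣leftPart∣ N M)))

  sub∉S : ∀ e → sub e ∉ S
  sub∉S e sub∈S with S-original sub∈S
  ... | _ , eq = ↑ˡ≢↑ʳ _ _ (sym eq)

  chosenPath : ∀ {a b} → a <ᶠ b → ShortestPath H (orig a) (orig b)
  chosenPath {a} {b} a<b =
    g (orig a) (orig b) (orig∈sg (proj₁ S-sg-set) a) (orig∈sg (proj₁ S-sg-set) b) (orig-< a<b)

  X₀ : Subset N
  X₀ = take N X

  Meets : Fin M → Set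
  Meets e = proj₁ (endpoints e) ∈ X₀ ⊎ proj₂ (endpoints e) ∈ X₀

  meets? : ∀ e → Dec (Meets e)
  meets? e = (proj₁ (endpoints e) ∈? X₀) ⊎-dec (proj₂ (endpoints e) ∈? X₀)

  meets : ∀ {a e} → Incident a e → a ∈ X₀ → Meets e
  meets (inj₁ refl) a∈X₀ = inj₁ a∈X₀
  meets (inj₂ refl) a∈X₀ = inj₂ a∈X₀

  -- The edge of a route at its end that is not known to lie in X₀.
  farEdge : ∀ {x y k a b} {p : Walk H x y k} → Route p a b → a ∈ X₀ ⊎ b ∈ X₀ → Fin M
  farEdge r (inj₁ _) = Route.last r
  farEdge r (inj₂ _) = Route.first r

  -- On a route from a to b where a or b is in X₀, an edge avoiding X₀ whose subdivision
  -- vertex is on the route is the far edge: the edge at the X₀ end meets X₀.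
  avoider-far : ∀ {x y k a b e} {p : Walk H x y k} (r : Route p a b) (hit : a ∈ X₀ ⊎ b ∈ X₀) →
                ¬ Meets e → OnWalk (sub e) p → e ≡ farEdge r hit
  avoider-far r (inj₁ a∈X₀) ¬meets on with Route.subs-on r _ on
  ... | inj₁ refl   = ⊥-elim (¬meets (meets (Route.first-at r) a∈X₀))
  ... | inj₂ e≡last = e≡last
  avoider-far r (inj₂ b∈X₀) ¬meets on with Route.subs-on r _ on
  ... | inj₁ e≡first = e≡first
  ... | inj₂ refl    = ⊥-elim (¬meets (meets (Route.last-at r) b∈X₀))

  -- On a route of length at most 2 its single edge meets X₀, so nothing avoiding X₀ is on it.
  no-avoider-short : ∀ {x y k a b e} {p : Walk H x y k} (r : Route p a b) → a ∈ X₀ ⊎ b ∈ X₀ →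
                     k ≤ 2 → ¬ Meets e → ¬ OnWalk (sub e) p
  no-avoider-short r (inj₁ a∈X₀) k≤2 ¬meets on with avoider-far r (inj₁ a∈X₀) ¬meets on
  ... | refl = ¬meets (meets (subst (Incident _) (Route.short r k≤2) (Route.first-at r)) a∈X₀)
  no-avoider-short r (inj₂ b∈X₀) k≤2 ¬meets on with avoider-far r (inj₂ b∈X₀) ¬meets on
  ... | refl = ¬meets (meets (subst (Incident _) (sym (Route.short r k≤2)) (Route.last-at r)) b∈X₀)

  data Charge (e : Fin M) : Set where
    own   : Meets e → Charge e
    along : ∀ {a b} (a<b : a <ᶠ b) → a ∈ X₀ ⊎ b ∈ X₀ → ¬ Meets e →
            OnWalk (sub e) (path (chosenPath a<b)) → Charge e

  -- Every edge is charged: if it avoids X₀, its subdivision vertex (which is not in X ⊆ S)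
  -- is covered by a chosen path between originals x < y with x or y in X.
  charge : ∀ e → Charge e
  charge e with meets? e | covered (sub e)
  ... | yes meets-e | _              = own meets-e
  ... | no _        | inj₁ sub∈X     = ⊥-elim (sub∉S e (X⊆S sub∈X))
  ... | no ¬meets   | inj₂ (x , y , x∈S , y∈S , x<y , hit , on) with S-original x∈S | S-original y∈S
  ...   | a , refl | b , refl =
    along (orig-<⁻ x<y) (Sum.map (∈-take N X) (∈-take N X) hit) ¬meets
      (subst (λ sp → OnWalk (sub e) (path sp)) (choice-irrelevant g _ _ _ _ _ _) on)

  chargedPair : ∀ {e} → Charge e → HitPair X₀
  chargedPair {e} (own meets-e)           = hitPair _ _ (endpoints-ordered e) meets-e
  chargedPair (along {a} {b} a<b hit _ _) = hitPair a b a<b hit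

  own-along : ∀ {a b e f} (a<b : a <ᶠ b) → Incident a e → Incident b e → a ∈ X₀ ⊎ b ∈ X₀ →
              ¬ Meets f → ¬ OnWalk (sub f) (path (chosenPath a<b))
  own-along {a} {b} a<b a∈e b∈e hit =
    no-avoider-short (shortest-route conn sp (FinP.<⇒≢ a<b)) hit (minimal sp 2 (two-step a∈e b∈e))
    where
    sp : ShortestPath H (orig a) (orig b)
    sp = chosenPath a<b

  along-along : ∀ {a b e f} (a<b a<b′ : a <ᶠ b) → a ∈ X₀ ⊎ b ∈ X₀ → ¬ Meets e → ¬ Meets f →
                OnWalk (sub e) (path (chosenPath a<b)) → OnWalk (sub f) (path (chosenPath a<b′)) → e ≡ f
  along-along {a} {b} a<b a<b′ hit ¬meets-e ¬meets-f on-e on-f rewrite FinP.<-irrelevant a<b′ a<b =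
    trans (avoider-far r hit ¬meets-e on-e) (sym (avoider-far r hit ¬meets-f on-f))
    where
    r : Route (path (chosenPath a<b)) a b
    r = shortest-route conn (chosenPath a<b) (FinP.<⇒≢ a<b)

  charge-injective : ∀ {e f} (c : Charge e) (d : Charge f) →
                     lo (chargedPair c) ≡ lo (chargedPair d) → hi (chargedPair c) ≡ hi (chargedPair d) →
                     e ≡ f
  charge-injective (own _) (own _) lo≡ hi≡ = endpoints-injective (cong₂ _,_ lo≡ hi≡)
  charge-injective (own _) (along a<b hit ¬meets on) lo≡ hi≡ =
    ⊥-elim (own-along a<b (inj₁ (sym lo≡)) (inj₂ (sym hi≡)) hit ¬meets on)
  charge-injective (along a<b hit ¬meets on) (own _) lo≡ hi≡ =
    ⊥-elim (own-along a<b (inj₁ lo≡) (inj₂ hi≡) hit ¬meets on)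
  charge-injective (along a<b hit ¬meets-e on-e) (along a<b′ _ ¬meets-f on-f) refl refl =
    along-along a<b a<b′ hit ¬meets-e ¬meets-f on-e on-f

  edges-bound : M ≤ sumTo N ∣ X₀ ∣
  edges-bound = hitPairs-bound X₀ (chargedPair ∘ charge) (λ e f → charge-injective (charge e) (charge f))

  core-size : ∀ k → IsLeast (λ j → M ≤ sumTo N j) k → k ≤ ∣ X ∣
  core-size k (_ , k-least) = ≤-trans (k-least ∣ X₀ ∣ edges-bound) (∣take∣≤ N X)

proposition2p3 : (G : SimpleGraph) → Connected (toGraph G) →
    SgEq (hatS G) (n G) ×
    (∀ k → IsLeast (λ j → m G ≤ sumTo (n G) j) k → SgcGe (hatS G) k)
proposition2p3 G conn =
  StrongGeodetic.sg-value G conn ,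
  λ k k-least S X S-sg-set X-core → CoreBound.core-size G conn S X S-sg-set X-core k k-least
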